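{- Let $n$ be sufficiently large and let $G$ be a $C_3^{(3)}$-saturated $3$-uniform hypergraph on $n$ vertices with exactly $\mathrm{sat}_3(n,C_3^{(3)})$ edges. If $e=\{a,b,c\}$ is an edge of $G$ and $ab$ is a good pair, then $c$ is a double neighbor of $a$ or of $b$.
   Context: $C_3^{(3)}$ is the $3$-uniform loose cycle with three edges (vertices $v_1,\dots,v_6$, edges $\{v_1,v_2,v_3\},\{v_3,v_4,v_5\},\{v_5,v_6,v_1\}$). $G$ is $C_3^{(3)}$-saturated if it contains no copy of $C_3^{(3)}$ but adding any $3$-set that is not an edge creates one; $\mathrm{sat}_3(n,C_3^{(3)})$ is the minimum number of edges of such an $n$-vertex $3$-uniform hypergraph. For vertices $u,v$, a $u,v$-link is a pair of edges $f_1,f_2$ of $G$ with $|f_1\cap f_2|=1$, $u\in f_1\setminus f_2$ and $v\in f_2\setminus f_1$ (a $2$-edge loose path from $u$ to $v$). The pair $uv$ is good if a $u,v$-link exists and bad otherwise. $d(uw)$ is the number of edges containing both $u$ and $w$; $w$ is a double neighbor of $u$ if $d(uw)\geq 2$. -}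

module Defs where

open import Data.Nat using (ℕ; _≤_)
open import Data.Fin using (Fin; _<_)
open import Data.List using (List; length)
open import Data.List.Membership.Propositional using (_∈_)
open import Data.List.Relation.Unary.Unique.Propositional using (Unique)
open import Data.Product using (Σ; ∃; ∃-syntax; _×_; _,_)
open import Data.Sum using (_⊎_)
open import Relation.Binary.PropositionalEquality using (_≡_; _≢_)
open import Relation.Nullary using (¬_)

-- A 3-subset of the vertex set Fin n, stored canonically as x < y < z.
record Triple (n : ℕ) : Set where
  constructor triple
  field
    x y z : Fin n
    x<y : x < y
    y<z : y < z

open Triple public

_∈ₜ_ : {n : ℕ} → Fin n → Triple n → Set
v ∈ₜ t = v ≡ x t ⊎ (v ≡ y t ⊎ v ≡ z t)

record Hypergraph3 (n : ℕ) : Set where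
  field
    edges : List (Triple n)
    nodup : Unique edges

open Hypergraph3 public

∣E∣ : {n : ℕ} → Hypergraph3 n → ℕ
∣E∣ G = length (edges G)

Distinct3 : {n : ℕ} → Fin n → Fin n → Fin n → Set
Distinct3 a b c = a ≢ b × (a ≢ c × b ≢ c)

HasEdge : {n : ℕ} → Hypergraph3 n → Fin n → Fin n → Fin n → Set
HasEdge G a b c =
  Distinct3 a b c × (Σ (Triple _) λ e → e ∈ edges G × (a ∈ₜ e × (b ∈ₜ e × c ∈ₜ e)))

SameSet : {n : ℕ} → Fin n → Fin n → Fin n → Fin n → Fin n → Fin n → Set
SameSet p q r a b c =
  Distinct3 p q r × (Mem p × (Mem q × Mem r))
  where
  Mem : Fin _ → Set
  Mem v = v ≡ a ⊎ (v ≡ b ⊎ v ≡ c)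

ContainsC3 : {n : ℕ} → (Fin n → Fin n → Fin n → Set) → Set
ContainsC3 {n} E =
  Σ (Fin n) λ v1 → Σ (Fin n) λ v2 → Σ (Fin n) λ v3 →
  Σ (Fin n) λ v4 → Σ (Fin n) λ v5 → Σ (Fin n) λ v6 →
    (v1 ≢ v2 × v1 ≢ v3 × v1 ≢ v4 × v1 ≢ v5 × v1 ≢ v6 ×
     v2 ≢ v3 × v2 ≢ v4 × v2 ≢ v5 × v2 ≢ v6 ×
     v3 ≢ v4 × v3 ≢ v5 × v3 ≢ v6 ×
     v4 ≢ v5 × v4 ≢ v6 ×
     v5 ≢ v6) ×
    (E v1 v2 v3 × E v3 v4 v5 × E v5 v6 v1)

AddEdge : {n : ℕ} → Hypergraph3 n → Fin n → Fin n → Fin n → (Fin n → Fin n → Fin n → Set)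
AddEdge G a b c p q r = HasEdge G p q r ⊎ SameSet p q r a b c

Saturated : {n : ℕ} → Hypergraph3 n → Set
Saturated {n} G =
  ¬ ContainsC3 (HasEdge G) ×
  ((a b c : Fin n) → Distinct3 a b c → ¬ HasEdge G a b c →
     ContainsC3 (AddEdge G a b c))

IsExtremal : {n : ℕ} → Hypergraph3 n → Set
IsExtremal {n} G = Saturated G × ((H : Hypergraph3 n) → Saturated H → ∣E∣ G ≤ ∣E∣ H)

Link : {n : ℕ} → Hypergraph3 n → Fin n → Fin n → Set
Link {n} G u v =
  Σ (Triple n) λ f1 → Σ (Triple n) λ f2 →
    f1 ∈ edges G × f2 ∈ edges G ×
    (Σ (Fin n) λ w → w ∈ₜ f1 × w ∈ₜ f2 × ((t : Fin n) → t ∈ₜ f1 → t ∈ₜ f2 → t ≡ w)) ×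
    (u ∈ₜ f1 × ¬ (u ∈ₜ f2)) × (v ∈ₜ f2 × ¬ (v ∈ₜ f1))

Good : {n : ℕ} → Hypergraph3 n → Fin n → Fin n → Set
Good G u v = Link G u v

DoubleNeighbor : {n : ℕ} → Hypergraph3 n → Fin n → Fin n → Set
DoubleNeighbor {n} G u w =
  Σ (Triple n) λ e1 → Σ (Triple n) λ e2 →
    e1 ≢ e2 × e1 ∈ edges G × e2 ∈ edges G ×
    (u ∈ₜ e1 × w ∈ₜ e1) × (u ∈ₜ e2 × w ∈ₜ e2)

{-# OPTIONS --safe #-}
-- Let f₁ ∋ a, w, y and f₂ ∋ w, b, x be the edges of an a,b-link
-- meeting in w. If c lies in f₁ (resp. f₂), then f₁ and e are two edges through a and c (resp.
-- b and c), distinct because b ∉ f₁ (resp. a ∉ f₂). Otherwise e, f₂, f₁ form the loose triangle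
-- a c b x w y.
module Submission where

open import Defs
open import Data.Nat using (ℕ; _≥_)
open import Data.Fin using (Fin; _≟_)
open import Data.Fin.Properties using (<⇒≢; <-trans)
open import Data.Product using (Σ; _×_; _,_; proj₁; proj₂)
open import Data.Sum using (_⊎_; inj₁; inj₂)
open import Data.Empty using (⊥-elim)
open import Data.List.Membership.Propositional using (_∈_)
open import Relation.Nullary using (¬_; Dec; yes; no)
open import Relation.Binary.PropositionalEquality using (_≢_; refl; ≢-sym; subst)

module _ {n : ℕ} where

  _∈ₜ?_ : (v : Fin n) (t : Triple n) → Dec (v ∈ₜ t)
  v ∈ₜ? t with v ≟ x t | v ≟ y t | v ≟ z t
  ... | yes v≡x | _       | _       = yes (inj₁ v≡x)
  ... | no _    | yes v≡y | _       = yes (inj₂ (inj₁ v≡y))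
  ... | no _    | no _    | yes v≡z = yes (inj₂ (inj₂ v≡z))
  ... | no v≢x  | no v≢y  | no v≢z  =
    no λ { (inj₁ v≡x) → v≢x v≡x ; (inj₂ (inj₁ v≡y)) → v≢y v≡y ; (inj₂ (inj₂ v≡z)) → v≢z v≡z }

  ∈∧∉⇒≢ : (t : Triple n) {u v : Fin n} → u ∈ₜ t → ¬ (v ∈ₜ t) → u ≢ v
  ∈∧∉⇒≢ t u∈t v∉t refl = v∉t u∈t

  x≢y : (t : Triple n) → x t ≢ y t
  x≢y t = <⇒≢ (x<y t)

  y≢z : (t : Triple n) → y t ≢ z t
  y≢z t = <⇒≢ (y<z t)

  x≢z : (t : Triple n) → x t ≢ z t
  x≢z t = <⇒≢ (<-trans (x<y t) (y<z t))

  thirdVertex : (t : Triple n) {p q : Fin n} → p ∈ₜ t → q ∈ₜ t → p ≢ q →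
                Σ (Fin n) λ r → r ∈ₜ t × r ≢ p × r ≢ q
  thirdVertex t (inj₁ refl)        (inj₂ (inj₁ refl)) _ = z t , inj₂ (inj₂ refl) , ≢-sym (x≢z t) , ≢-sym (y≢z t)
  thirdVertex t (inj₂ (inj₁ refl)) (inj₁ refl)        _ = z t , inj₂ (inj₂ refl) , ≢-sym (y≢z t) , ≢-sym (x≢z t)
  thirdVertex t (inj₁ refl)        (inj₂ (inj₂ refl)) _ = y t , inj₂ (inj₁ refl) , ≢-sym (x≢y t) , y≢z t
  thirdVertex t (inj₂ (inj₂ refl)) (inj₁ refl)        _ = y t , inj₂ (inj₁ refl) , y≢z t , ≢-sym (x≢y t)
  thirdVertex t (inj₂ (inj₁ refl)) (inj₂ (inj₂ refl)) _ = x t , inj₁ refl , x≢y t , x≢z t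
  thirdVertex t (inj₂ (inj₂ refl)) (inj₂ (inj₁ refl)) _ = x t , inj₁ refl , x≢z t , x≢y t
  thirdVertex t (inj₁ refl)        (inj₁ refl)        p≢q = ⊥-elim (p≢q refl)
  thirdVertex t (inj₂ (inj₁ refl)) (inj₂ (inj₁ refl)) p≢q = ⊥-elim (p≢q refl)
  thirdVertex t (inj₂ (inj₂ refl)) (inj₂ (inj₂ refl)) p≢q = ⊥-elim (p≢q refl)

  doubleNeighbor-of-sharedEdges : (G : Hypergraph3 n) {u w v : Fin n} {e f : Triple n} →
    e ∈ edges G → f ∈ edges G → u ∈ₜ e → w ∈ₜ e → u ∈ₜ f → w ∈ₜ f →
    v ∈ₜ e → ¬ (v ∈ₜ f) → DoubleNeighbor G u w
  doubleNeighbor-of-sharedEdges G {v = v} {e} {f} e∈G f∈G u∈e w∈e u∈f w∈f v∈e v∉f =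
    e , f , (λ e≡f → v∉f (subst (v ∈ₜ_) e≡f v∈e)) , e∈G , f∈G , (u∈e , w∈e) , (u∈f , w∈f)

  link-avoiding-edge⇒C3 : (G : Hypergraph3 n) {a b c : Fin n} →
    HasEdge G a b c → (link : Link G a b) →
    ¬ (c ∈ₜ proj₁ link) → ¬ (c ∈ₜ proj₁ (proj₂ link)) → ContainsC3 (HasEdge G)
  link-avoiding-edge⇒C3 G {a} {b} {c} ((a≢b , a≢c , b≢c) , e , e∈G , a∈e , b∈e , c∈e)
    (f₁ , f₂ , f₁∈G , f₂∈G , (w , w∈f₁ , w∈f₂ , f₁∩f₂⊆w) , (a∈f₁ , a∉f₂) , (b∈f₂ , b∉f₁)) c∉f₁ c∉f₂
    with thirdVertex f₁ a∈f₁ w∈f₁ (≢-sym (∈∧∉⇒≢ f₂ w∈f₂ a∉f₂))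
       | thirdVertex f₂ b∈f₂ w∈f₂ (≢-sym (∈∧∉⇒≢ f₁ w∈f₁ b∉f₁))
  ... | y , y∈f₁ , y≢a , y≢w | x , x∈f₂ , x≢b , x≢w =
    a , c , b , x , w , y ,
    (a≢c , a≢b , ≢-sym (∈∧∉⇒≢ f₂ x∈f₂ a∉f₂) , ≢-sym w≢a , ≢-sym y≢a ,
     ≢-sym b≢c , ≢-sym (∈∧∉⇒≢ f₂ x∈f₂ c∉f₂) , ≢-sym (∈∧∉⇒≢ f₂ w∈f₂ c∉f₂) , ≢-sym (∈∧∉⇒≢ f₁ y∈f₁ c∉f₁) ,
     ≢-sym x≢b , ≢-sym w≢b , ≢-sym (∈∧∉⇒≢ f₁ y∈f₁ b∉f₁) ,
     x≢w , x≢y′ ,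
     ≢-sym y≢w) ,
    ((a≢c , a≢b , ≢-sym b≢c) , e , e∈G , a∈e , c∈e , b∈e) ,
    ((≢-sym x≢b , ≢-sym w≢b , x≢w) , f₂ , f₂∈G , b∈f₂ , x∈f₂ , w∈f₂) ,
    ((≢-sym y≢w , w≢a , y≢a) , f₁ , f₁∈G , w∈f₁ , y∈f₁ , a∈f₁)
    where
    w≢a : w ≢ a
    w≢a = ∈∧∉⇒≢ f₂ w∈f₂ a∉f₂
    w≢b : w ≢ b
    w≢b = ∈∧∉⇒≢ f₁ w∈f₁ b∉f₁
    x≢y′ : x ≢ y
    x≢y′ x≡y = y≢w (f₁∩f₂⊆w y y∈f₁ (subst (_∈ₜ f₂) x≡y x∈f₂))

  C3-free⇒goodEdge-doubleNeighbor : (G : Hypergraph3 n) → ¬ ContainsC3 (HasEdge G) →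
    (a b c : Fin n) → HasEdge G a b c → Good G a b →
    DoubleNeighbor G a c ⊎ DoubleNeighbor G b c
  C3-free⇒goodEdge-doubleNeighbor G C3-free a b c abc@(_ , e , e∈G , a∈e , b∈e , c∈e)
    link@(f₁ , f₂ , f₁∈G , f₂∈G , _ , (a∈f₁ , a∉f₂) , (b∈f₂ , b∉f₁))
    with c ∈ₜ? f₁ | c ∈ₜ? f₂
  ... | yes c∈f₁ | _ = inj₁ (doubleNeighbor-of-sharedEdges G e∈G f₁∈G a∈e c∈e a∈f₁ c∈f₁ b∈e b∉f₁)
  ... | no _ | yes c∈f₂ = inj₂ (doubleNeighbor-of-sharedEdges G e∈G f₂∈G b∈e c∈e b∈f₂ c∈f₂ a∈e a∉f₂)
  ... | no c∉f₁ | no c∉f₂ = ⊥-elim (C3-free (link-avoiding-edge⇒C3 G abc link c∉f₁ c∉f₂))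

claim4p5 : Σ ℕ λ n₀ → (n : ℕ) → n ≥ n₀ → (G : Hypergraph3 n) → IsExtremal G →
    (a b c : Fin n) → HasEdge G a b c → Good G a b →
    DoubleNeighbor G a c ⊎ DoubleNeighbor G b c
claim4p5 = 0 , λ n _ G ((C3-free , _) , _) → C3-free⇒goodEdge-doubleNeighbor G C3-free
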